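{- Let $K_n$ be the complete graph with vertex set $V=\{v_1,\dots,v_n\}$ and let $(\mathbf d,\mathbf r)$ be an arithmetical structure on $K_n$. Let $S_n$ be the star graph with centre $v$ and leaves $v_1,\dots,v_n$. Define $\tilde{\mathbf d},\tilde{\mathbf r}$ on the vertices of $S_n$ by $\tilde d_u=d_u+1$ and $\tilde r_u=r_u$ for $u\in V$, and $\tilde d_v=1$, $\tilde r_v=\sum_{u\in V} r_u$. Then $(\tilde{\mathbf d},\tilde{\mathbf r})$ is an arithmetical structure on $S_n$.
   Context: For a finite connected graph $G$ with adjacency matrix $A$, an arithmetical structure on $G$ is a pair $(\mathbf d,\mathbf r)$ of vectors of positive integers indexed by the vertices such that $\mathbf r$ is primitive (gcd of entries equal to $1$) and $(\mathrm{diag}(\mathbf d)-A)\mathbf r=0$. -}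

module Defs where

open import Data.Nat using (ℕ; zero; suc; _+_; _*_; _<_)
open import Data.Nat.GCD using (gcd)
open import Data.Fin using (Fin; zero; suc)
open import Data.Fin.Properties using (_≟_)
open import Data.Vec.Functional using (Vector; foldr)
open import Relation.Nullary using (does)
open import Data.Bool using (if_then_else_)
open import Relation.Binary.PropositionalEquality using (_≡_)
open import Data.Product using (_×_)

Σ : {m : ℕ} → (Fin m → ℕ) → ℕ
Σ = foldr _+_ 0

-- gcd of all entries of a vector (gcd of the empty family is 0).
gcdAll : {m : ℕ} → (Fin m → ℕ) → ℕ
gcdAll = foldr gcd 0

Adj : ℕ → Set
Adj m = Fin m → Fin m → ℕ

-- (d , r) is an arithmetical structure for adjacency matrix A:
-- d, r positive, r primitive, and (diag(d) - A) r = 0, i.e. for every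
-- vertex i, d_i r_i = Σ_j A_ij r_j (all entries are natural numbers).
IsArithmeticalStructure : {m : ℕ} → Adj m → (Fin m → ℕ) → (Fin m → ℕ) → Set
IsArithmeticalStructure {m} A d r =
  ((i : Fin m) → 0 < d i) ×
  ((i : Fin m) → 0 < r i) ×
  (gcdAll r ≡ 1) ×
  ((i : Fin m) → d i * r i ≡ Σ (λ j → A i j * r j))

completeGraph : (n : ℕ) → Adj n
completeGraph n i j = if does (i ≟ j) then 0 else 1

-- Star graph S_n on Fin (suc n): vertex zero is the centre v,
-- vertex suc i is the leaf v_i.
starGraph : (n : ℕ) → Adj (suc n)
starGraph n zero    zero    = 0
starGraph n zero    (suc j) = 1
starGraph n (suc i) zero    = 1
starGraph n (suc i) (suc j) = 0

starD : {n : ℕ} → (Fin n → ℕ) → Fin (suc n) → ℕ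
starD d zero    = 1
starD d (suc i) = d i + 1

starR : {n : ℕ} → (Fin n → ℕ) → Fin (suc n) → ℕ
starR r zero    = Σ r
starR r (suc i) = r i

{-# OPTIONS --safe #-}
-- In K_n the neighbours of u carry total weight Σ r − r_u, so the balance
-- condition d_u r_u = Σ r − r_u at u is exactly (d_u + 1) r_u = Σ r, the balance
-- condition at the leaf u of S_n; at the centre it reads 1 · Σ r = Σ r.
-- Primitivity survives because gcd (Σ r, gcd r) = gcd (Σ r, 1) = 1.
module Submission where

open import Defs
open import Data.Nat using (ℕ; zero; suc; _+_; _*_; _<_; s≤s; z≤n)
open import Data.Nat.Properties using (+-comm; +-assoc; *-identityˡ; *-distribʳ-+; m≤m+n; m≤n+m; <-≤-trans; +-*-semiring)
open import Data.Nat.GCD using (gcd; gcd-zeroʳ)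
open import Data.Fin using (Fin; zero; suc)
open import Data.Product using (_,_)
open import Algebra.Properties.Semiring.Sum +-*-semiring using (*-distribˡ-sum)
open import Relation.Binary.PropositionalEquality using (_≡_; sym; trans; cong; cong₂; module ≡-Reasoning)

Σ-*ˡ : ∀ {m} c (f : Fin m → ℕ) → Σ (λ j → c * f j) ≡ c * Σ f
Σ-*ˡ c f = sym (*-distribˡ-sum c f)

Σ-completeGraph-row+diag : ∀ {m} (f : Fin m → ℕ) (i : Fin m) →
  Σ (λ j → completeGraph m i j * f j) + f i ≡ Σ f
Σ-completeGraph-row+diag {suc m} f zero = begin
  Σ (λ j → 1 * f (suc j)) + f zero ≡⟨ +-comm _ (f zero) ⟩
  f zero + Σ (λ j → 1 * f (suc j)) ≡⟨ cong (f zero +_) (trans (Σ-*ˡ 1 (λ j → f (suc j))) (*-identityˡ _)) ⟩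
  Σ f                               ∎
  where open ≡-Reasoning
Σ-completeGraph-row+diag {suc m} f (suc i) = begin
  (1 * f zero + Σ (λ j → completeGraph m i j * f (suc j))) + f (suc i)
    ≡⟨ +-assoc (1 * f zero) _ _ ⟩
  1 * f zero + (Σ (λ j → completeGraph m i j * f (suc j)) + f (suc i))
    ≡⟨ cong₂ _+_ (*-identityˡ (f zero)) (Σ-completeGraph-row+diag (λ j → f (suc j)) i) ⟩
  Σ f
    ∎
  where open ≡-Reasoning

Σ-starGraph-row : ∀ {n} (r : Fin n → ℕ) (i : Fin (suc n)) →
  Σ (λ j → starGraph n i j * starR r j) ≡ Σ r
Σ-starGraph-row r zero    = trans (Σ-*ˡ 1 r) (*-identityˡ (Σ r))
Σ-starGraph-row r (suc i) = trans (cong (1 * Σ r +_) (Σ-*ˡ 0 r)) (trans (+-comm _ 0) (*-identityˡ (Σ r)))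

starGraph-balanced : ∀ {n} (d r : Fin n → ℕ) →
  (∀ i → d i * r i ≡ Σ (λ j → completeGraph n i j * r j)) →
  ∀ i → starD d i * starR r i ≡ Σ (λ j → starGraph n i j * starR r j)
starGraph-balanced d r balanced zero    = trans (*-identityˡ _) (sym (Σ-starGraph-row r zero))
starGraph-balanced {n} d r balanced (suc i) = begin
  (d i + 1) * r i                                  ≡⟨ *-distribʳ-+ (r i) (d i) 1 ⟩
  d i * r i + 1 * r i                              ≡⟨ cong₂ _+_ (balanced i) (*-identityˡ (r i)) ⟩
  Σ (λ j → completeGraph n i j * r j) + r i        ≡⟨ Σ-completeGraph-row+diag r i ⟩
  Σ r                                              ≡⟨ sym (Σ-starGraph-row r (suc i)) ⟩
  Σ (λ j → starGraph n (suc i) j * starR r j)      ∎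
  where open ≡-Reasoning

mainTheorem12 : (n : ℕ) (d r : Fin n → ℕ) →
    IsArithmeticalStructure (completeGraph n) d r →
    IsArithmeticalStructure (starGraph n) (starD d) (starR r)
mainTheorem12 zero    d r (_ , _ , () , _)
mainTheorem12 (suc n) d r (d>0 , r>0 , r-primitive , balanced) =
  starD>0 , starR>0 , starR-primitive , starGraph-balanced d r balanced
  where
  starD>0 : ∀ i → 0 < starD d i
  starD>0 zero    = s≤s z≤n
  starD>0 (suc i) = m≤n+m 1 (d i)

  starR>0 : ∀ i → 0 < starR r i
  starR>0 zero    = <-≤-trans (r>0 zero) (m≤m+n (r zero) _)
  starR>0 (suc i) = r>0 i

  starR-primitive : gcd (Σ r) (gcdAll r) ≡ 1
  starR-primitive = trans (cong (gcd (Σ r)) r-primitive) (gcd-zeroʳ (Σ r))
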